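{- Let $G$ be a finite simple graph of order $n \ge 2$ without isolated vertices, and let $S$ be a dominating set of $M(G)$. Then there exists a dominating set $S'$ of $M(G)$ with $S' \subseteq E(G)$ and $|S'| \le |S|$.
   Context: For a finite simple graph $G$, the middle graph $M(G)$ is the graph with vertex set $V(G)\cup E(G)$ (so $E(G)\subseteq V(M(G))$) in which two elements $x,y$ are adjacent if and only if either (1) $x,y\in E(G)$ and the edges $x,y$ share a common endpoint in $G$, or (2) $x\in V(G)$, $y\in E(G)$ and $x$ is an endpoint of $y$ (or vice versa). A dominating set of a graph $H$ is a set $S\subseteq V(H)$ such that every vertex of $H$ is in $S$ or adjacent to a vertex of $S$. -}

module Defs where

open import Data.Nat using (ℕ; _≤_)
open import Data.Fin using (Fin; _<_)
open import Data.Bool using (Bool; T)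
open import Data.Product using (Σ; ∃; _×_; _,_; proj₁; proj₂)
open import Data.Sum using (_⊎_; inj₁; inj₂)
open import Data.List using (List; length)
open import Data.List.Membership.Propositional using (_∈_)
open import Data.List.Relation.Unary.Unique.Propositional using (Unique)
open import Data.List.Relation.Unary.All using (All)
open import Relation.Binary.PropositionalEquality using (_≡_)
open import Relation.Nullary using (¬_)

record Graph (n : ℕ) : Set where
  field
    adj   : Fin n → Fin n → Bool
    irrefl : ∀ i → ¬ T (adj i i)
    sym    : ∀ i j → T (adj i j) → T (adj j i)
open Graph public

-- Edges: unordered pairs {i,j}, represented canonically by i < j.
Edge : ∀ {n} → Graph n → Set
Edge {n} G = Σ (Fin n × Fin n) λ p → (proj₁ p < proj₂ p) × T (adj G (proj₁ p) (proj₂ p))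

_isEndOf_ : ∀ {n} {G : Graph n} → Fin n → Edge G → Set
v isEndOf ((i , j) , _) = (v ≡ i) ⊎ (v ≡ j)

shareEnd : ∀ {n} {G : Graph n} → Edge G → Edge G → Set
shareEnd {G = G} e f = ¬ (e ≡ f) × Σ _ λ v → (_isEndOf_ {G = G} v e) × (_isEndOf_ {G = G} v f)

MVert : ∀ {n} → Graph n → Set
MVert {n} G = Fin n ⊎ Edge G

MAdj : ∀ {n} (G : Graph n) → MVert G → MVert G → Set
MAdj G (inj₁ v) (inj₁ w) = Data.Empty.⊥
  where import Data.Empty
MAdj G (inj₁ v) (inj₂ e) = _isEndOf_ {G = G} v e
MAdj G (inj₂ e) (inj₁ v) = _isEndOf_ {G = G} v e
MAdj G (inj₂ e) (inj₂ f) = shareEnd {G = G} e f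

-- a finite set of vertices of M(G), given as a duplicate-free list
-- (its cardinality is its length)
IsDominating : ∀ {n} (G : Graph n) → List (MVert G) → Set
IsDominating G S = ∀ x → (x ∈ S) ⊎ Σ (MVert G) λ y → (y ∈ S) × MAdj G y x

NoIsolated : ∀ {n} → Graph n → Set
NoIsolated {n} G = ∀ i → Σ (Fin n) λ j → T (adj G i j)

EdgesOnly : ∀ {n} {G : Graph n} → List (MVert G) → Set
EdgesOnly {G = G} S = All (λ x → Σ (Edge G) λ e → x ≡ inj₂ e) S

-- Since G has no isolated vertex, every vertex v of G lies on some
-- chosen edge e(v).  Replace each vertex v in S by e(v) and keep each edge.
-- Whatever a vertex v dominates in M(G) (v itself and the edges at v) is
-- still dominated by e(v): v is an endpoint of e(v), and an edge at v either
-- is e(v) or shares the endpoint v with it.  Edges dominate what they did.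
-- Deleting duplicates from the image list keeps it dominating, makes it
-- duplicate-free, and cannot make it longer than S.
module Submission where

open import Defs
open import Data.Nat using (ℕ; _≤_; z≤n; s≤s)
open import Data.Nat.Properties using (≤-trans)
open import Data.Product using (Σ; _×_; _,_; proj₁; proj₂)
import Data.Product.Properties as Product
open import Data.Sum using (_⊎_; inj₁; inj₂)
import Data.Sum.Properties as Sum
open import Data.List using (List; []; _∷_; length; map; deduplicate)
open import Data.List.Properties using (length-filter; length-map)
open import Data.List.Relation.Unary.All using ([]; _∷_)
open import Data.List.Relation.Unary.All.Properties using (deduplicate⁺)
open import Data.List.Relation.Unary.Unique.Propositional using (Unique)
open import Data.List.Relation.Unary.Unique.DecPropositional.Properties using (deduplicate-!)
open import Data.List.Membership.Propositional using (_∈_)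
open import Data.List.Membership.Propositional.Properties using (∈-map⁺; deduplicate-∈⇔)
open import Data.Fin using (Fin)
import Data.Fin.Properties as Fin
open import Data.Bool using (T)
open import Data.Bool.Properties using (T-irrelevant)
open import Data.Empty using (⊥-elim)
open import Function.Bundles using (Equivalence)
open import Relation.Binary.PropositionalEquality using (_≡_; refl; subst)
open import Relation.Binary.Definitions using (DecidableEquality; tri<; tri≈; tri>)
open import Relation.Nullary using (yes; no; ¬?)

length-deduplicate : ∀ {a} {A : Set a} (_≟_ : DecidableEquality A) (xs : List A) →
  length (deduplicate _≟_ xs) ≤ length xs
length-deduplicate _≟_ []       = z≤n
length-deduplicate _≟_ (x ∷ xs) =
  s≤s (≤-trans (length-filter (λ y → ¬? (x ≟ y)) (deduplicate _≟_ xs))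
               (length-deduplicate _≟_ xs))

module _ {n : ℕ} (G : Graph n) where

  Covers : MVert G → MVert G → Set
  Covers y x = (y ≡ x) ⊎ MAdj G y x

  dominating : (S : List (MVert G)) → (∀ x → Σ (MVert G) λ y → y ∈ S × Covers y x) →
    IsDominating G S
  dominating S cover x with cover x
  ... | y , y∈S , inj₁ refl = inj₁ y∈S
  ... | y , y∈S , inj₂ adj  = inj₂ (y , y∈S , adj)

  covering : (S : List (MVert G)) → IsDominating G S →
    ∀ x → Σ (MVert G) λ y → y ∈ S × Covers y x
  covering S dom x with dom x
  ... | inj₁ x∈S             = x , x∈S , inj₁ refl
  ... | inj₂ (y , y∈S , adj) = y , y∈S , inj₂ adj

  dominating-transfer : (f : MVert G → MVert G) → (∀ {y x} → Covers y x → Covers (f y) x) →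
    (S T : List (MVert G)) → (∀ {y} → y ∈ S → f y ∈ T) →
    IsDominating G S → IsDominating G T
  dominating-transfer f f-covers S T image domS = dominating T λ x →
    let (y , y∈S , y-covers-x) = covering S domS x
    in  f y , image y∈S , f-covers y-covers-x

  -- Edges are determined by their endpoint pair (the proofs are irrelevant),
  -- so edges, and hence vertices of M(G), have decidable equality.
  _≟ᴱ_ : DecidableEquality (Edge G)
  _≟ᴱ_ = Product.≡-dec (Product.≡-dec Fin._≟_ Fin._≟_)
           (λ p q → yes (Product.×-≡,≡→≡ (Fin.<-irrelevant _ _ , T-irrelevant _ _)))

  _≟ᴹ_ : DecidableEquality (MVert G)
  _≟ᴹ_ = Sum.≡-dec Fin._≟_ _≟ᴱ_

  incidentEdge : (i j : Fin n) → T (adj G i j) → Σ (Edge G) λ e → _isEndOf_ {G = G} i e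
  incidentEdge i j ij with Fin.<-cmp i j
  ... | tri< i<j _ _    = ((i , j) , i<j , ij) , inj₁ refl
  ... | tri≈ _ refl _   = ⊥-elim (irrefl G i ij)
  ... | tri> _ _ j<i    = ((j , i) , j<i , sym G i j ij) , inj₂ refl

  module _ (noIsolated : NoIsolated G) where

    chosenEdge : Fin n → Edge G
    chosenEdge v = proj₁ (incidentEdge v (proj₁ (noIsolated v)) (proj₂ (noIsolated v)))

    chosenEdge-incident : ∀ v → _isEndOf_ {G = G} v (chosenEdge v)
    chosenEdge-incident v = proj₂ (incidentEdge v (proj₁ (noIsolated v)) (proj₂ (noIsolated v)))

    toEdge : MVert G → MVert G
    toEdge (inj₁ v) = inj₂ (chosenEdge v)
    toEdge (inj₂ e) = inj₂ e

    toEdge-edgesOnly : ∀ S → EdgesOnly {G = G} (map toEdge S)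
    toEdge-edgesOnly []           = []
    toEdge-edgesOnly (inj₁ v ∷ S) = (chosenEdge v , refl) ∷ toEdge-edgesOnly S
    toEdge-edgesOnly (inj₂ e ∷ S) = (e , refl) ∷ toEdge-edgesOnly S

    -- e(v) covers everything v covers: v itself (as an endpoint of e(v)) and
    -- every edge at v (equal to e(v) or sharing the endpoint v with it).
    toEdge-covers : ∀ {y x} → Covers y x → Covers (toEdge y) x
    toEdge-covers {inj₂ e} covers = covers
    toEdge-covers {inj₁ v} (inj₁ refl) = inj₂ (chosenEdge-incident v)
    toEdge-covers {inj₁ v} {inj₁ w} (inj₂ ())
    toEdge-covers {inj₁ v} {inj₂ e} (inj₂ v∈e) with chosenEdge v ≟ᴱ e
    ... | yes refl = inj₁ refl
    ... | no e≢    = inj₂ (e≢ , v , chosenEdge-incident v , v∈e)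

lemma2p1 : (n : ℕ) → 2 ≤ n → (G : Graph n) → NoIsolated G →
    (S : List (MVert G)) → Unique S → IsDominating G S →
    Σ (List (MVert G)) λ S′ → Unique S′ × EdgesOnly {G = G} S′ × IsDominating G S′ × length S′ ≤ length S
lemma2p1 n _ G noIsolated S _ domS =
  S′ , deduplicate-! (_≟ᴹ_ G) (map f S)
     , deduplicate⁺ (_≟ᴹ_ G) (toEdge-edgesOnly G noIsolated S)
     , dominating-transfer G f (toEdge-covers G noIsolated) S S′ image domS
     , subst (length S′ ≤_) (length-map f S) (length-deduplicate (_≟ᴹ_ G) (map f S))
  where
    f : MVert G → MVert G
    f = toEdge G noIsolated

    S′ : List (MVert G)
    S′ = deduplicate (_≟ᴹ_ G) (map f S)

    image : ∀ {y} → y ∈ S → f y ∈ S′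
    image y∈S = Equivalence.to (deduplicate-∈⇔ (_≟ᴹ_ G)) (∈-map⁺ f y∈S)
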